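{- Let $C : \mathsf{Form} \to \mathsf{Prop}$ be any predicate, $\mathsf{Code}$ any type and $\mathsf{eval} : \mathsf{Code} \to \mathsf{Code} \to \mathsf{Form}$ any function. Assume: (i) for every function $f : \mathsf{Code} \to \mathsf{Form}$ there exists $c \in \mathsf{Code}$ such that for all $x \in \mathsf{Code}$, $\mathsf{eval}(c,x) \simeq_C f(x)$; (ii) for all formulas $A,B$, if $C(A \to B)$ and $C(A)$ then $C(B)$; (iii) for every formula $A$, $C(A) \lor C(\neg A)$. Then there exists a formula $B$ such that $B \simeq_C \neg B$, and $C(B) \lor C(\neg B)$, and $C(\bot)$.
   Context: $\mathsf{Form}$ is the type of closed formulas generated by $A,B ::= \bot \mid A \to B$; $\neg A$ abbreviates $A \to \bot$. For a predicate $C$ on $\mathsf{Form}$, $A \simeq_C B$ means $C(A \to B) \land C(B \to A)$. -}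

module Defs where

open import Data.Product using (_×_)

data Form : Set where
  ⊥F  : Form
  _⇒_ : Form → Form → Form

infixr 20 _⇒_

¬F_ : Form → Form
¬F A = A ⇒ ⊥F

_≃[_]_ : Form → (Form → Set) → Form → Set
A ≃[ C ] B = C (A ⇒ B) × C (B ⇒ A)

-- Diagonalising the representation of x ↦ ¬ eval x x yields a liar sentence
-- B ≃ ¬B. Whichever of B, ¬B the predicate C contains, two applications of
-- modus ponens produce C ⊥.
module Submission where

open import Defs
open import Data.Product using (_×_; Σ; _,_)
open import Data.Sum using (_⊎_; inj₁; inj₂)

ClosedUnderMP : (Form → Set) → Set
ClosedUnderMP C = (A B : Form) → C (A ⇒ B) → C A → C B

diagonal : (C : Form → Set) (Code : Set) (eval : Code → Code → Form)
  → ((f : Code → Form) → Σ Code (λ c → (x : Code) → eval c x ≃[ C ] f x))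
  → (g : Form → Form) → Σ Form (λ B → B ≃[ C ] g B)
diagonal C Code eval represent g with represent (λ x → g (eval x x))
... | c , eval-c≃ = eval c c , eval-c≃ c

liar⇒⊥ : (C : Form → Set) → ClosedUnderMP C
  → (B : Form) → B ≃[ C ] (¬F B) → C B ⊎ C (¬F B) → C ⊥F
liar⇒⊥ C mp B (B⇒¬B , ¬B⇒B) (inj₁ CB)  = mp B ⊥F (mp B (¬F B) B⇒¬B CB) CB
liar⇒⊥ C mp B (B⇒¬B , ¬B⇒B) (inj₂ C¬B) = mp B ⊥F C¬B (mp (¬F B) B ¬B⇒B C¬B)

theorem3p7 : (C : Form → Set) (Code : Set) (eval : Code → Code → Form)
    → ((f : Code → Form) → Σ Code (λ c → (x : Code) → eval c x ≃[ C ] f x))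
    → ((A B : Form) → C (A ⇒ B) → C A → C B)
    → ((A : Form) → C A ⊎ C (¬F A))
    → Σ Form (λ B → (B ≃[ C ] (¬F B)) × (C B ⊎ C (¬F B)) × C ⊥F)
theorem3p7 C Code eval represent mp decides with diagonal C Code eval represent ¬F_
... | B , B≃¬B = B , B≃¬B , decides B , liar⇒⊥ C mp B B≃¬B (decides B)
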